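{- Let $(H,s,t)$ be an inherent two-rooted graph. Then for every graph $H'$, the two-rooted graph $(H+H',s,t)$ is also inherent, where $H+H'$ denotes the disjoint union of $H$ and $H'$.
   Context: Graphs are finite, simple and undirected. A two-rooted graph is a triple $(H,s,t)$ with $H$ a graph and $s,t\in V(H)$ not necessarily distinct. A copy of $(\hat H,\hat s,\hat t)$ in $G$ is $(H,s,t)$ with $H$ an induced subgraph of $G$ and an isomorphism $\hat H\to H$ mapping $\hat s\mapsto s$, $\hat t\mapsto t$. An extension of a copy $(H,s,t)$ in $G$ is $(H',s',t')$ with $H'$ an induced subgraph of $G$, $V(H')=V(H)\cup\{s',t'\}$, $s'\ne t'$ not in $V(H)$, $H'-\{s',t'\}=H$, and $s$ (resp. $t$) the unique neighbour of $s'$ (resp. $t'$) in $H'$; it is closable if there is an induced $s',t'$-path in $G$ all of whose internal vertices lie outside $N_G[V(H)]$. A copy is avoidable if all its extensions are closable. $(\hat H,\hat s,\hat t)$ is inherent if every graph containing an induced subgraph isomorphic to $\hat H$ contains an avoidable copy of $(\hat H,\hat s,\hat t)$. -}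

module Defs where

open import Data.Nat using (ℕ; zero; suc; _<_; _+_)
open import Data.Fin using (Fin; toℕ; fromℕ; splitAt; _↑ˡ_)
open import Data.Bool using (Bool; true; false)
open import Data.Sum using (_⊎_; inj₁; inj₂)
open import Data.Product using (Σ; _×_; _,_; ∃)
open import Relation.Nullary using (¬_)
open import Relation.Binary.PropositionalEquality using (_≡_; _≢_; refl)
open import Function.Definitions using (Injective)

record Graph : Set where
  field
    size   : ℕ
    adj    : Fin size → Fin size → Bool
    sym    : ∀ u v → adj u v ≡ adj v u
    irrefl : ∀ u → adj u u ≡ false
open Graph public

V : Graph → Set
V G = Fin (size G)

Adj : (G : Graph) → V G → V G → Set
Adj G u v = adj G u v ≡ true

-- A two-rooted graph (H, s, t); s and t need not be distinct.
record TwoRooted : Set where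
  constructor ⟨_,_,_⟩
  field
    graph : Graph
    s     : V graph
    t     : V graph
open TwoRooted public

-- Disjoint union H + H' (vertices of H first, then those of H').
du-adj : (H H' : Graph) → Fin (size H + size H') → Fin (size H + size H') → Bool
du-adj H H' u v with splitAt (size H) u | splitAt (size H) v
... | inj₁ a | inj₁ b = adj H a b
... | inj₂ a | inj₂ b = adj H' a b
... | inj₁ _ | inj₂ _ = false
... | inj₂ _ | inj₁ _ = false

du-sym : (H H' : Graph) → ∀ u v → du-adj H H' u v ≡ du-adj H H' v u
du-sym H H' u v with splitAt (size H) u | splitAt (size H) v
... | inj₁ a | inj₁ b = sym H a b
... | inj₂ a | inj₂ b = sym H' a b
... | inj₁ _ | inj₂ _ = refl
... | inj₂ _ | inj₁ _ = refl

du-irrefl : (H H' : Graph) → ∀ u → du-adj H H' u u ≡ false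
du-irrefl H H' u with splitAt (size H) u
... | inj₁ a = irrefl H a
... | inj₂ a = irrefl H' a

_⊕_ : Graph → Graph → Graph
H ⊕ H' = record
  { size   = size H + size H'
  ; adj    = du-adj H H'
  ; sym    = du-sym H H'
  ; irrefl = du-irrefl H H' }

_+R_ : TwoRooted → Graph → TwoRooted
R +R H' = ⟨ graph R ⊕ H' , s R ↑ˡ size H' , t R ↑ˡ size H' ⟩

-- An induced embedding of H into G: its image is an induced subgraph of G
-- isomorphic to H (via f).
record Embedding (H G : Graph) : Set where
  field
    f      : V H → V G
    f-inj  : Injective _≡_ _≡_ f
    f-adj  : ∀ u v → adj G (f u) (f v) ≡ adj H u v
open Embedding public

Contains : Graph → Graph → Set
Contains G H = Embedding H G

-- A copy of the two-rooted graph R in G: the image of an embedding e,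
-- with roots e(ŝ), e(t̂).
Copy : TwoRooted → Graph → Set
Copy R G = Embedding (graph R) G

module _ {R : TwoRooted} {G : Graph} (c : Copy R G) where
  private
    H = graph R
    e = f c

  InCopy : V G → Set
  InCopy v = ∃ λ (x : V H) → e x ≡ v

  InClosedNbhd : V G → Set
  InClosedNbhd v = ∃ λ (x : V H) → (e x ≡ v) ⊎ Adj G v (e x)

  record Extension : Set where
    field
      s' t'   : V G
      s'≢t'   : s' ≢ t'
      s'∉     : ¬ InCopy s'
      t'∉     : ¬ InCopy t'
      s'-s    : Adj G s' (e (s R))
      s'-only : ∀ x → x ≢ s R → adj G s' (e x) ≡ false
      t'-t    : Adj G t' (e (t R))
      t'-only : ∀ x → x ≢ t R → adj G t' (e x) ≡ false
      s'≁t'   : adj G s' t' ≡ false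

  record AvoidingInducedPath (a b : V G) : Set where
    field
      k        : ℕ
      p        : Fin (suc k) → V G
      p-inj    : Injective _≡_ _≡_ p
      p-start  : p Data.Fin.zero ≡ a
      p-end    : p (fromℕ k) ≡ b
      p-edges  : ∀ i j → Adj G (p i) (p j) → (suc (toℕ i) ≡ toℕ j ⊎ suc (toℕ j) ≡ toℕ i)
      p-path   : ∀ i j → suc (toℕ i) ≡ toℕ j → Adj G (p i) (p j)
      p-avoid  : ∀ i → 0 < toℕ i → toℕ i < k → ¬ InClosedNbhd (p i)

  Closable : Extension → Set
  Closable x = AvoidingInducedPath (Extension.s' x) (Extension.t' x)

  Avoidable : Set
  Avoidable = ∀ (x : Extension) → Closable x

Inherent : TwoRooted → Set
Inherent R = ∀ (G : Graph) → Contains G (graph R) → Σ (Copy R G) (λ c → Avoidable {R} {G} c)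

-- Let G contain H + H' and let W be the copy of H' in it. Deleting the closed
-- neighbourhood of W leaves an induced subgraph J that still contains H, so
-- J has an avoidable copy C of (H, s, t). Together with W it is a copy of
-- (H + H', s, t) in G, and it is avoidable: the only-neighbour conditions
-- push every extension of it into J, where it is an extension of C, and a
-- closing path for C in J avoids N[W] simply because it lies in J.
module Submission where

open import Defs
open import Data.Nat using (ℕ)
open import Data.Fin using (Fin; zero; suc; splitAt; join; _↑ˡ_; _↑ʳ_; _≟_)
open import Data.Fin.Properties
  using (splitAt-↑ˡ; splitAt-↑ʳ; join-splitAt; ↑ˡ-injective; ↑ʳ-injective; any?)
open import Data.Bool using (true; false)
import Data.Bool.Properties as Bool
open import Data.Sum using (_⊎_; inj₁; inj₂; [_,_]′)
open import Data.Product using (∃; _×_; _,_; proj₁; proj₂)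
open import Data.List using (List; _∷_; lookup; filter; allFin)
open import Data.List.Relation.Unary.All as All using (_∷_)
open import Data.List.Relation.Unary.AllPairs using (_∷_)
open import Data.List.Relation.Unary.Any using (index)
open import Data.List.Relation.Unary.Any.Properties using (lookup-index)
open import Data.List.Relation.Unary.Unique.Propositional using (Unique)
import Data.List.Relation.Unary.Unique.Propositional.Properties as Unique
open import Data.List.Membership.Propositional.Properties
  using (∈-lookup; ∈-filter⁺; ∈-filter⁻; ∈-allFin)
open import Data.Empty using (⊥-elim)
open import Function using (_∘_)
open import Function.Definitions using (Injective)
open import Level using (0ℓ)
open import Relation.Nullary using (¬_; ¬?)
open import Relation.Nullary.Decidable using (_⊎-dec_)
open import Relation.Unary using (Pred; Decidable)
open import Relation.Binary.PropositionalEquality as ≡ using (_≡_; _≢_; refl; cong; cong₂)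

Adj⇒¬nonadjacent : ∀ {G u v} → Adj G u v → adj G u v ≢ false
Adj⇒¬nonadjacent = Bool.not-¬

lookup-injective : ∀ {A : Set} {xs : List A} → Unique xs → Injective _≡_ _≡_ (lookup xs)
lookup-injective {xs = _ ∷ _} _            {zero}  {zero}  _  = refl
lookup-injective {xs = _ ∷ _} (x∉ ∷ _)     {zero}  {suc j} eq = ⊥-elim (All.lookup x∉ (∈-lookup j) eq)
lookup-injective {xs = _ ∷ _} (x∉ ∷ _)     {suc i} {zero}  eq = ⊥-elim (All.lookup x∉ (∈-lookup i) (≡.sym eq))
lookup-injective {xs = _ ∷ _} (_ ∷ unique) {suc i} {suc j} eq = cong suc (lookup-injective unique eq)

splitAt-injective : ∀ m {n} → Injective _≡_ _≡_ (splitAt m {n})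
splitAt-injective m {n} {u} {v} eq =
  ≡.trans (≡.sym (join-splitAt m n u)) (≡.trans (cong (join m n) eq) (join-splitAt m n v))

record Enumeration {n : ℕ} (P : Pred (Fin n) 0ℓ) : Set where
  field
    card            : ℕ
    elem            : Fin card → Fin n
    elem-injective  : Injective _≡_ _≡_ elem
    elem-satisfies  : ∀ i → P (elem i)
    elem-surjective : ∀ v → P v → ∃ λ i → elem i ≡ v

enumerate : ∀ {n} {P : Pred (Fin n) 0ℓ} → Decidable P → Enumeration P
enumerate {n} P? = record
  { card            = _
  ; elem            = lookup members
  ; elem-injective  = lookup-injective (Unique.filter⁺ P? (Unique.allFin⁺ n))
  ; elem-satisfies  = λ i → proj₂ (∈-filter⁻ P? {xs = allFin n} (∈-lookup i))
  ; elem-surjective = λ v Pv →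
      let v∈ = ∈-filter⁺ P? (∈-allFin v) Pv in index v∈ , ≡.sym (lookup-index v∈)
  }
  where
  members : List (Fin n)
  members = filter P? (allFin n)

_∘ᴱ_ : ∀ {K H G} → Embedding H G → Embedding K H → Embedding K G
e ∘ᴱ d = record
  { f     = f e ∘ f d
  ; f-inj = λ eq → f-inj d (f-inj e eq)
  ; f-adj = λ u v → ≡.trans (f-adj e (f d u) (f d v)) (f-adj d u v)
  }

induced : (G : Graph) {m : ℕ} → (Fin m → V G) → Graph
induced G {m} ι = record
  { size   = m
  ; adj    = λ a b → adj G (ι a) (ι b)
  ; sym    = λ a b → sym G (ι a) (ι b)
  ; irrefl = λ a → irrefl G (ι a)
  }

inclusion : ∀ G {m} {ι : Fin m → V G} → Injective _≡_ _≡_ ι → Embedding (induced G ι) G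
inclusion G {ι = ι} ι-injective = record
  { f = ι ; f-inj = ι-injective ; f-adj = λ _ _ → refl }

corestrict : ∀ {H G m} {ι : Fin m → V G} (e : Embedding H G) →
             (∀ x → ∃ λ i → ι i ≡ f e x) → Embedding H (induced G ι)
corestrict {H} {G} {ι = ι} e preimage = record
  { f     = proj₁ ∘ preimage
  ; f-inj = λ {x} {y} eq → f-inj e (≡.trans (≡.sym (ι-pre x)) (≡.trans (cong ι eq) (ι-pre y)))
  ; f-adj = λ x y → ≡.trans (cong₂ (adj G) (ι-pre x) (ι-pre y)) (f-adj e x y)
  }
  where
  ι-pre : ∀ x → ι (proj₁ (preimage x)) ≡ f e x
  ι-pre = proj₂ ∘ preimage

module _ (H K : Graph) where

  ↑ˡ-embedding : Embedding H (H ⊕ K)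
  ↑ˡ-embedding = record
    { f     = _↑ˡ size K
    ; f-inj = λ {x} {y} → ↑ˡ-injective (size K) x y
    ; f-adj = adj-↑ˡ
    }
    where
    adj-↑ˡ : ∀ x y → adj (H ⊕ K) (x ↑ˡ size K) (y ↑ˡ size K) ≡ adj H x y
    adj-↑ˡ x y rewrite splitAt-↑ˡ (size H) x (size K) | splitAt-↑ˡ (size H) y (size K) = refl

  ↑ʳ-embedding : Embedding K (H ⊕ K)
  ↑ʳ-embedding = record
    { f     = size H ↑ʳ_
    ; f-inj = ↑ʳ-injective (size H) _ _
    ; f-adj = adj-↑ʳ
    }
    where
    adj-↑ʳ : ∀ x y → adj (H ⊕ K) (size H ↑ʳ x) (size H ↑ʳ y) ≡ adj K x y
    adj-↑ʳ x y rewrite splitAt-↑ʳ (size H) (size K) x | splitAt-↑ʳ (size H) (size K) y = refl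

  ⊕-nonadjacent : ∀ x y → adj (H ⊕ K) (x ↑ˡ size K) (size H ↑ʳ y) ≡ false
  ⊕-nonadjacent x y rewrite splitAt-↑ˡ (size H) x (size K) | splitAt-↑ʳ (size H) (size K) y = refl

  ↑ˡ≢↑ʳ : ∀ x y → x ↑ˡ size K ≢ size H ↑ʳ y
  ↑ˡ≢↑ʳ x y eq with () ← ≡.trans (≡.sym (splitAt-↑ˡ (size H) x (size K)))
                                 (≡.trans (cong (splitAt (size H)) eq) (splitAt-↑ʳ (size H) (size K) y))

module Copairing {H K G : Graph} (a : Embedding H G) (b : Embedding K G)
         (disjoint : ∀ x y → f a x ≢ f b y)
         (nonadjacent : ∀ x y → adj G (f a x) (f b y) ≡ false) where

  private
    g : Fin (size H) ⊎ Fin (size K) → V G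
    g = [ f a , f b ]′

    g-injective : Injective _≡_ _≡_ g
    g-injective {inj₁ x} {inj₁ y} eq = cong inj₁ (f-inj a eq)
    g-injective {inj₂ x} {inj₂ y} eq = cong inj₂ (f-inj b eq)
    g-injective {inj₁ x} {inj₂ y} eq = ⊥-elim (disjoint x y eq)
    g-injective {inj₂ x} {inj₁ y} eq = ⊥-elim (disjoint y x (≡.sym eq))

  copair : Embedding (H ⊕ K) G
  copair = record { f = g ∘ splitAt (size H) ; f-inj = injective ; f-adj = adjacency }
    where
    injective : Injective _≡_ _≡_ (g ∘ splitAt (size H))
    injective {u} {v} eq =
      splitAt-injective (size H) (g-injective {splitAt (size H) u} {splitAt (size H) v} eq)

    adjacency : ∀ u v → adj G (g (splitAt (size H) u)) (g (splitAt (size H) v)) ≡ adj (H ⊕ K) u v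
    adjacency u v with splitAt (size H) u | splitAt (size H) v
    ... | inj₁ x | inj₁ y = f-adj a x y
    ... | inj₂ x | inj₂ y = f-adj b x y
    ... | inj₁ x | inj₂ y = nonadjacent x y
    ... | inj₂ x | inj₁ y = ≡.trans (sym G (f b x) (f a y)) (nonadjacent y x)

  copair-↑ˡ : ∀ x → f copair (x ↑ˡ size K) ≡ f a x
  copair-↑ˡ x = cong g (splitAt-↑ˡ (size H) x (size K))

  copair-↑ʳ : ∀ y → f copair (size H ↑ʳ y) ≡ f b y
  copair-↑ʳ y = cong g (splitAt-↑ʳ (size H) (size K) y)

module Outside {K G : Graph} (b : Embedding K G) where

  Near : V G → Set
  Near v = ∃ λ y → (f b y ≡ v) ⊎ Adj G v (f b y)

  near? : Decidable Near
  near? v = any? (λ y → (f b y ≟ v) ⊎-dec (adj G v (f b y) Bool.≟ true))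

  open Enumeration (enumerate (¬? ∘ near?)) public

  J : Graph
  J = induced G elem

  far-≢ : ∀ w y → elem w ≢ f b y
  far-≢ w y eq = elem-satisfies w (y , inj₁ (≡.sym eq))

  far-nonadjacent : ∀ w y → adj G (elem w) (f b y) ≡ false
  far-nonadjacent w y = Bool.¬-not (λ w~y → elem-satisfies w (y , inj₂ w~y))

  module _ {R : TwoRooted} (c : Copy R J) where
    open Copairing (inclusion G elem-injective ∘ᴱ c) b (far-≢ ∘ f c) (far-nonadjacent ∘ f c)

    private
      n : ℕ
      n = size (graph R)

    attach : Copy (R +R K) G
    attach = copair

    extension-vertex-far : ∀ z r → ¬ InCopy {R +R K} {G} attach z →
      (∀ x → x ≢ r ↑ˡ size K → adj G z (f attach x) ≡ false) → ¬ Near z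
    extension-vertex-far z r z∉ _    (y , inj₁ eq) = z∉ (n ↑ʳ y , ≡.trans (copair-↑ʳ y) eq)
    extension-vertex-far z r _  only (y , inj₂ z~) = Adj⇒¬nonadjacent {G} z~
      (≡.trans (cong (adj G z) (≡.sym (copair-↑ʳ y)))
               (only (n ↑ʳ y) (λ eq → ↑ˡ≢↑ʳ (graph R) K r y (≡.sym eq))))

    restrict : (X : Extension {R +R K} {G} attach) → ∃ λ (Y : Extension {R} {J} c) →
               elem (Extension.s' Y) ≡ Extension.s' X × elem (Extension.t' Y) ≡ Extension.t' X
    restrict X = Y , s''≡s' , t''≡t'
      where
      open Extension X

      s'-in-J : ∃ λ w → elem w ≡ s'
      s'-in-J = elem-surjective s' (extension-vertex-far s' (s R) s'∉ s'-only)

      t'-in-J : ∃ λ w → elem w ≡ t'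
      t'-in-J = elem-surjective t' (extension-vertex-far t' (t R) t'∉ t'-only)

      s'' t'' : V J
      s'' = proj₁ s'-in-J
      t'' = proj₁ t'-in-J

      s''≡s' : elem s'' ≡ s'
      s''≡s' = proj₂ s'-in-J

      t''≡t' : elem t'' ≡ t'
      t''≡t' = proj₂ t'-in-J

      outside-copy : ∀ {w z} → elem w ≡ z → ¬ InCopy {R +R K} {G} attach z → ¬ InCopy {R} {J} c w
      outside-copy eq z∉ (x , cx≡w) =
        z∉ (x ↑ˡ size K , ≡.trans (copair-↑ˡ x) (≡.trans (cong elem cx≡w) eq))

      adj-via : ∀ {w z} → elem w ≡ z → ∀ x →
                adj G (elem w) (elem (f c x)) ≡ adj G z (f attach (x ↑ˡ size K))
      adj-via eq x = cong₂ (adj G) eq (≡.sym (copair-↑ˡ x))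

      Y : Extension {R} {J} c
      Y = record
        { s'      = s''
        ; t'      = t''
        ; s'≢t'   = λ eq → s'≢t' (≡.trans (≡.sym s''≡s') (≡.trans (cong elem eq) t''≡t'))
        ; s'∉     = outside-copy s''≡s' s'∉
        ; t'∉     = outside-copy t''≡t' t'∉
        ; s'-s    = ≡.trans (adj-via s''≡s' (s R)) s'-s
        ; s'-only = λ x x≢s →
            ≡.trans (adj-via s''≡s' x) (s'-only (x ↑ˡ size K) (x≢s ∘ ↑ˡ-injective _ x _))
        ; t'-t    = ≡.trans (adj-via t''≡t' (t R)) t'-t
        ; t'-only = λ x x≢t →
            ≡.trans (adj-via t''≡t' x) (t'-only (x ↑ˡ size K) (x≢t ∘ ↑ˡ-injective _ x _))
        ; s'≁t'   = ≡.trans (cong₂ (adj G) s''≡s' t''≡t') s'≁t'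
        }

    closedNbhd-restrict : ∀ w → InClosedNbhd {R +R K} {G} attach (elem w) → InClosedNbhd {R} {J} c w
    closedNbhd-restrict w (u , h) with splitAt n u
    closedNbhd-restrict w (u , inj₁ eq) | inj₁ x = x , inj₁ (elem-injective eq)
    closedNbhd-restrict w (u , inj₂ w~) | inj₁ x = x , inj₂ w~
    closedNbhd-restrict w (u , h)       | inj₂ y = ⊥-elim (elem-satisfies w (y , h))

    lift-path : ∀ {a a'} → AvoidingInducedPath {R} {J} c a a' →
                AvoidingInducedPath {R +R K} {G} attach (elem a) (elem a')
    lift-path π = record
      { k       = k
      ; p       = elem ∘ p
      ; p-inj   = p-inj ∘ elem-injective
      ; p-start = cong elem p-start
      ; p-end   = cong elem p-end
      ; p-edges = p-edges
      ; p-path  = p-path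
      ; p-avoid = λ i 0<i i<k → p-avoid i 0<i i<k ∘ closedNbhd-restrict (p i)
      }
      where open AvoidingInducedPath π

    attach-avoidable : Avoidable {R} {J} c → Avoidable {R +R K} {G} attach
    attach-avoidable avoidable X with restrict X
    ... | Y , s''≡s' , t''≡t' =
      ≡.subst₂ (AvoidingInducedPath {R +R K} {G} attach) s''≡s' t''≡t' (lift-path (avoidable Y))

module _ {H K G : Graph} (E : Embedding (H ⊕ K) G) where
  open Outside (E ∘ᴱ ↑ʳ-embedding H K)

  left-far : ∀ x → ¬ Near (f E (x ↑ˡ size K))
  left-far x (y , inj₁ eq)  = ↑ˡ≢↑ʳ H K x y (f-inj E (≡.sym eq))
  left-far x (y , inj₂ x~y) =
    Adj⇒¬nonadjacent {G} x~y (≡.trans (f-adj E _ _) (⊕-nonadjacent H K x y))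

  left-outside : Embedding H J
  left-outside = corestrict (E ∘ᴱ ↑ˡ-embedding H K) (λ x → elem-surjective _ (left-far x))

proposition5p8 : (R : TwoRooted) → Inherent R → (H' : Graph) → Inherent (R +R H')
proposition5p8 R inherent H' G E = attach {R} C , attach-avoidable C C-avoidable
  where
  open Outside (E ∘ᴱ ↑ʳ-embedding (graph R) H')
  C : Copy R J
  C = proj₁ (inherent J (left-outside {graph R} {H'} E))

  C-avoidable : Avoidable {R} {J} C
  C-avoidable = proj₂ (inherent J (left-outside {graph R} {H'} E))
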